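{- Let $G$ be a nut graph. Then $o_e(G) \geq o_v(G) + 1$.
   Context: All graphs are finite, simple and connected. For a graph $G$ with adjacency matrix $\mathbf{A}(G)$, the nullity $\eta(G)$ is the dimension of $\ker \mathbf{A}(G)$. A nut graph is a graph $G$ with $\eta(G) = 1$ such that a non-zero vector $\mathbf{x}$ spanning $\ker\mathbf{A}(G)$ has no zero entry. By convention the isolated vertex $K_1$ is regarded as a trivial case and is not considered a nut graph (non-trivial nut graphs have at least $7$ vertices). $\mathrm{Aut}(G)$ denotes the full automorphism group of $G$; $o_v(G)$ is the number of orbits of $\mathrm{Aut}(G)$ on $V(G)$ and $o_e(G)$ is the number of orbits of $\mathrm{Aut}(G)$ on $E(G)$ (where $\alpha$ maps edge $\{u,v\}$ to $\{u^\alpha,v^\alpha\}$). -}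

module Defs where

open import Data.Nat using (ℕ; zero; suc; _≤_; _<_; _+_)
open import Data.Fin as Fin using (Fin)
open import Data.Bool using (Bool; true; false; if_then_else_)
open import Data.Rational using (ℚ; 0ℚ) renaming (_+_ to _+ℚ_; _*_ to _*ℚ_)
open import Data.Fin.Permutation using (Permutation′; _⟨$⟩ʳ_)
open import Data.Product using (Σ; ∃; _×_; _,_; proj₁; proj₂)
open import Data.Sum using (_⊎_)
open import Relation.Binary.PropositionalEquality using (_≡_; _≢_)
open import Relation.Nullary using (¬_)

record Graph (n : ℕ) : Set where
  field
    adj   : Fin n → Fin n → Bool
    sym   : ∀ u v → adj u v ≡ adj v u
    irrefl : ∀ u → adj u u ≡ false
open Graph public

data Reach {n : ℕ} (G : Graph n) : Fin n → Fin n → Set where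
  here : ∀ {u} → Reach G u u
  step : ∀ {u v w} → adj G u v ≡ true → Reach G v w → Reach G u w

Connected : ∀ {n} → Graph n → Set
Connected {n} G = ∀ (u v : Fin n) → Reach G u v

sumFin : ∀ n → (Fin n → ℚ) → ℚ
sumFin zero    f = 0ℚ
sumFin (suc n) f = f Fin.zero +ℚ sumFin n (λ i → f (Fin.suc i))

mulA : ∀ {n} → Graph n → (Fin n → ℚ) → Fin n → ℚ
mulA {n} G x i = sumFin n (λ j → if adj G i j then x j else 0ℚ)

InKernel : ∀ {n} → Graph n → (Fin n → ℚ) → Set
InKernel G x = ∀ i → mulA G x i ≡ 0ℚ

NonZeroVec : ∀ {n} → (Fin n → ℚ) → Set
NonZeroVec {n} x = Σ (Fin n) (λ i → x i ≢ 0ℚ)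

-- x is a non-zero vector spanning ker A(G)  (so η(G) = 1 iff such x exists)
SpansKernel : ∀ {n} → Graph n → (Fin n → ℚ) → Set
SpansKernel {n} G x =
  InKernel G x × NonZeroVec x ×
  (∀ (y : Fin n → ℚ) → InKernel G y → Σ ℚ (λ c → ∀ i → y i ≡ c *ℚ x i))

-- Nut graph: η(G) = 1, spanning kernel vector has no zero entry; K₁ excluded (n ≥ 2).
IsNut : ∀ {n} → Graph n → Set
IsNut {n} G = 2 ≤ n × Σ (Fin n → ℚ) (λ x → SpansKernel G x × (∀ i → x i ≢ 0ℚ))

IsAut : ∀ {n} → Graph n → Permutation′ n → Set
IsAut {n} G π = ∀ (u v : Fin n) → adj G (π ⟨$⟩ʳ u) (π ⟨$⟩ʳ v) ≡ adj G u v

Aut : ∀ {n} → Graph n → Set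
Aut {n} G = Σ (Permutation′ n) (IsAut G)

-- Edges {u,v}, represented canonically with u < v
Edge : ∀ {n} → Graph n → Set
Edge {n} G = Σ (Fin n) (λ u → Σ (Fin n) (λ v → (Fin.toℕ u < Fin.toℕ v) × adj G u v ≡ true))

SameVertexOrbit : ∀ {n} → (G : Graph n) → Fin n → Fin n → Set
SameVertexOrbit G u v = Σ (Aut G) (λ α → proj₁ α ⟨$⟩ʳ u ≡ v)

SameEdgeOrbit : ∀ {n} → (G : Graph n) → Edge G → Edge G → Set
SameEdgeOrbit G (u , v , _) (u' , v' , _) =
  Σ (Aut G) (λ α →
    ((proj₁ α ⟨$⟩ʳ u ≡ u') × (proj₁ α ⟨$⟩ʳ v ≡ v')) ⊎
    ((proj₁ α ⟨$⟩ʳ u ≡ v') × (proj₁ α ⟨$⟩ʳ v ≡ u')))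

-- "R has exactly k equivalence classes on X": a surjection onto Fin k whose
-- fibres are exactly the R-classes.
HasNClasses : (X : Set) → (X → X → Set) → ℕ → Set
HasNClasses X R k =
  Σ (X → Fin k) (λ f →
    (∀ (c : Fin k) → Σ X (λ a → f a ≡ c)) ×
    (∀ (a b : X) → (f a ≡ f b → R a b) × (R a b → f a ≡ f b)))

VertexOrbitCount : ∀ {n} → Graph n → ℕ → Set
VertexOrbitCount {n} G k = HasNClasses (Fin n) (SameVertexOrbit G) k

EdgeOrbitCount : ∀ {n} → Graph n → ℕ → Set
EdgeOrbitCount G k = HasNClasses (Edge G) (SameEdgeOrbit G) k

-- A spanning vector x of the kernel is mapped by every automorphism to a multiple of
-- itself, so the sign of x u * x v is constant on each edge orbit, and the kernel
-- equation at v forces every vertex to have neighbours of both signs.  For each vertex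
-- orbit O and sign s, pick an edge of sign s at a vertex of O and record which end of
-- its edge orbit O is: this injects 2 · o_v signed vertex orbits into the 2 · o_e
-- orientations of edge orbits.  If o_e ≤ o_v the injection is onto, and then "the other
-- end of the chosen edge" is, for each sign s, a fixed-point-free involution σ s of the
-- vertex orbits which every edge of sign s follows.  A word in two fixed-point-free
-- involutions fixing a point has even length, so walks of G between two vertices have
-- lengths of a fixed parity: G is bipartite.  But then x restricted to one colour class
-- is again in the kernel, contradicting η(G) = 1.

module Submission where

open import Defs hiding (sym)
open import Data.Nat as ℕ using (ℕ; zero; suc; _+_; _≤_; _<_; parity)
import Data.Nat.Properties as ℕ
open import Data.Parity.Base as ℙ using (Parity; 0ℙ; 1ℙ; _⁻¹)
import Data.Parity.Properties as ℙ
open import Data.Fin as Fin using (Fin)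
open import Data.Fin.Permutation using (_⟨$⟩ʳ_)
open import Data.Fin.Properties using (2↔Bool; *↔×; injective⇒≤; any?; toℕ-injective)
open import Data.Bool using (Bool; true; false; not; if_then_else_)
import Data.Bool.Properties as Bool
open import Data.List using (List; []; _∷_; _++_; length; reverse; [_]; foldr)
open import Data.List.Properties using (length-++; length-reverse; unfold-reverse)
open import Data.Rational as ℚ using (ℚ; 0ℚ; 1ℚ; 1/_)
import Data.Rational.Properties as ℚ
open import Data.Empty using (⊥)
open import Data.Product using (Σ; _×_; _,_; proj₁; proj₂; uncurry)
open import Data.Sum using (inj₁; inj₂)
open import Data.Product.Properties using (≡-dec)
open import Data.Product.Function.NonDependent.Propositional using (_×-↔_)
open import Algebra.Bundles using (Ring; CommutativeMonoid)
open import Algebra.Properties.CommutativeSemigroup (CommutativeMonoid.commutativeSemigroup ℚ.*-1-commutativeMonoid)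
  using (interchange)
open import Function using (_∘_; _↔_; Inverse; Injection; mk⇔; Injective)
open import Function.Properties.Inverse using (↔-sym; ↔-trans; ↔-refl; ↔⇒↣)
open import Relation.Binary.PropositionalEquality hiding ([_])
open import Relation.Binary.Definitions using (tri<; tri≈; tri>)
open import Relation.Nullary using (¬_; does; proof; contradiction; _×-dec_)
open import Relation.Nullary.Decidable using (does-⇔; decidable-stable)
open import Relation.Nullary.Reflects using (Reflects; invert)
open import Algebra.Properties.CommutativeMonoid.Sum ℚ.+-0-commutativeMonoid
  using (sum; sum-cong-≗; sum-permute; sum-replicate-zero)
open import Algebra.Properties.Semiring.Sum (Ring.semiring ℚ.+-*-ring) using (*-distribˡ-sum)

*-≢0 : ∀ {p q} → p ≢ 0ℚ → q ≢ 0ℚ → p ℚ.* q ≢ 0ℚ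
*-≢0 {p} {q} p≢0 q≢0 pq≡0 = q≢0 (begin
  q                    ≡⟨ ℚ.*-identityˡ q ⟨
  1ℚ ℚ.* q             ≡⟨ cong (ℚ._* q) (ℚ.*-inverseˡ p) ⟨
  (1/ p ℚ.* p) ℚ.* q   ≡⟨ ℚ.*-assoc (1/ p) p q ⟩
  1/ p ℚ.* (p ℚ.* q)   ≡⟨ cong (1/ p ℚ.*_) pq≡0 ⟩
  1/ p ℚ.* 0ℚ          ≡⟨ ℚ.*-zeroʳ (1/ p) ⟩
  0ℚ                   ∎)
  where
  open ≡-Reasoning
  instance
    p-nonZero : ℚ.NonZero p
    p-nonZero = ℚ.≢-nonZero p≢0

square-pos : ∀ c → c ≢ 0ℚ → 0ℚ ℚ.< c ℚ.* c
square-pos c c≢0 with ℚ.<-cmp c 0ℚ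
... | tri< c<0 _ _ = ℚ.positive⁻¹ (c ℚ.* c) {{ℚ.neg*neg⇒pos c {{ℚ.negative c<0}} c {{ℚ.negative c<0}}}}
... | tri≈ _ c≡0 _ = contradiction c≡0 c≢0
... | tri> _ _ c>0 = ℚ.positive⁻¹ (c ℚ.* c) {{ℚ.pos*pos⇒pos c {{ℚ.positive c>0}} c {{ℚ.positive c>0}}}}

isPositive : ℚ → Bool
isPositive q = does (0ℚ ℚ.<? q)

isPositive≡true⇒pos : ∀ {q} → isPositive q ≡ true → 0ℚ ℚ.< q
isPositive≡true⇒pos {q} q⁺ = invert (subst (Reflects (0ℚ ℚ.< q)) q⁺ (proof (0ℚ ℚ.<? q)))

isPositive≡false⇒nonPos : ∀ {q} → isPositive q ≡ false → q ℚ.≤ 0ℚ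
isPositive≡false⇒nonPos {q} q⁻ = ℚ.≮⇒≥ (invert (subst (Reflects (0ℚ ℚ.< q)) q⁻ (proof (0ℚ ℚ.<? q))))

isPositive-*-pos : ∀ {c} q → 0ℚ ℚ.< c → isPositive (c ℚ.* q) ≡ isPositive q
isPositive-*-pos {c} q c>0 = does-⇔ (mk⇔ cancel mono) (0ℚ ℚ.<? c ℚ.* q) (0ℚ ℚ.<? q)
  where
  instance
    c-positive : ℚ.Positive c
    c-positive = ℚ.positive c>0
    c-nonNegative : ℚ.NonNegative c
    c-nonNegative = ℚ.pos⇒nonNeg c
  cancel : 0ℚ ℚ.< c ℚ.* q → 0ℚ ℚ.< q
  cancel = ℚ.*-cancelˡ-<-nonNeg c ∘ subst (ℚ._< c ℚ.* q) (sym (ℚ.*-zeroʳ c))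
  mono : 0ℚ ℚ.< q → 0ℚ ℚ.< c ℚ.* q
  mono = subst (ℚ._< c ℚ.* q) (ℚ.*-zeroʳ c) ∘ ℚ.*-monoʳ-<-pos c

≢⇒≡⁻¹ : ∀ {p q : Parity} → p ≢ q → p ≡ q ⁻¹
≢⇒≡⁻¹ {0ℙ} {0ℙ} p≢q = contradiction refl p≢q
≢⇒≡⁻¹ {0ℙ} {1ℙ} _   = refl
≢⇒≡⁻¹ {1ℙ} {0ℙ} _   = refl
≢⇒≡⁻¹ {1ℙ} {1ℙ} p≢q = contradiction refl p≢q

parity-suc : ∀ m → parity (suc m) ≡ parity m ⁻¹
parity-suc m = sym (ℙ.⁻¹-selfInverse (ℙ.suc-homo-⁻¹ m))

parity-+≡0⇒≡ : ∀ m n → parity (m + n) ≡ 0ℙ → parity m ≡ parity n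
parity-+≡0⇒≡ m n m+n-even = sym (ℙ.+-cancelˡ-≡ (parity m) (parity n) (parity m) (begin
  parity m ℙ.+ parity n ≡⟨ ℙ.+-homo-+ m n ⟨
  parity (m + n)         ≡⟨ m+n-even ⟩
  0ℙ                     ≡⟨ ℙ.p+p≡0ℙ (parity m) ⟨
  parity m ℙ.+ parity m ∎))
  where open ≡-Reasoning

sumFin≡sum : ∀ n (f : Fin n → ℚ) → sumFin n f ≡ sum f
sumFin≡sum zero    f = refl
sumFin≡sum (suc n) f = cong (f Fin.zero ℚ.+_) (sumFin≡sum n (f ∘ Fin.suc))

nonNeg+nonNeg≡0 : ∀ {p q} → 0ℚ ℚ.≤ p → 0ℚ ℚ.≤ q → p ℚ.+ q ≡ 0ℚ → p ≡ 0ℚ × q ≡ 0ℚ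
nonNeg+nonNeg≡0 {p} {q} p≥0 q≥0 p+q≡0 =
  ℚ.≤-antisym (subst (p ℚ.≤_) p+q≡0 p≤p+q) p≥0 ,
  ℚ.≤-antisym (subst (q ℚ.≤_) p+q≡0 q≤p+q) q≥0
  where
  p≤p+q : p ℚ.≤ p ℚ.+ q
  p≤p+q = subst (ℚ._≤ p ℚ.+ q) (ℚ.+-identityʳ p) (ℚ.+-monoʳ-≤ p q≥0)
  q≤p+q : q ℚ.≤ p ℚ.+ q
  q≤p+q = subst (ℚ._≤ p ℚ.+ q) (ℚ.+-identityˡ q) (ℚ.+-monoˡ-≤ q p≥0)

sum-nonNeg : ∀ {n} (f : Fin n → ℚ) → (∀ i → 0ℚ ℚ.≤ f i) → 0ℚ ℚ.≤ sum f
sum-nonNeg {zero}  f f≥0 = ℚ.≤-refl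
sum-nonNeg {suc n} f f≥0 = ℚ.+-mono-≤ (f≥0 Fin.zero) (sum-nonNeg (f ∘ Fin.suc) (f≥0 ∘ Fin.suc))

nonNeg-sum≡0 : ∀ {n} (f : Fin n → ℚ) → (∀ i → 0ℚ ℚ.≤ f i) → sum f ≡ 0ℚ → ∀ i → f i ≡ 0ℚ
nonNeg-sum≡0 {suc n} f f≥0 Σf≡0 i = split i
  where
  summands≡0 : f Fin.zero ≡ 0ℚ × sum (f ∘ Fin.suc) ≡ 0ℚ
  summands≡0 = nonNeg+nonNeg≡0 (f≥0 Fin.zero) (sum-nonNeg (f ∘ Fin.suc) (f≥0 ∘ Fin.suc)) Σf≡0
  split : ∀ i → f i ≡ 0ℚ
  split Fin.zero    = proj₁ summands≡0
  split (Fin.suc i) = nonNeg-sum≡0 (f ∘ Fin.suc) (f≥0 ∘ Fin.suc) (proj₂ summands≡0) i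

injective-missing⇒< : ∀ {m k} {g : Fin m → Fin k} → Injective _≡_ _≡_ g → ∀ y → (∀ i → g i ≢ y) → m < k
injective-missing⇒< {m} {k} {g} g-injective y y∉g = injective⇒≤ g⁺-injective
  where
  g⁺ : Fin (suc m) → Fin k
  g⁺ Fin.zero    = y
  g⁺ (Fin.suc i) = g i
  g⁺-injective : Injective _≡_ _≡_ g⁺
  g⁺-injective {Fin.zero}  {Fin.zero}  _    = refl
  g⁺-injective {Fin.zero}  {Fin.suc j} y≡gj = contradiction (sym y≡gj) (y∉g j)
  g⁺-injective {Fin.suc i} {Fin.zero}  gi≡y = contradiction gi≡y (y∉g i)
  g⁺-injective {Fin.suc i} {Fin.suc j} gi≡gj = cong Fin.suc (g-injective gi≡gj)

Bool×Fin↔Fin : ∀ m → (Bool × Fin m) ↔ Fin (2 ℕ.* m)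
Bool×Fin↔Fin m = ↔-trans (↔-sym 2↔Bool ×-↔ ↔-refl) (↔-sym *↔×)

injective-missing⇒<-Bool× : ∀ {a b} {g : Bool × Fin a → Bool × Fin b} → Injective _≡_ _≡_ g →
  ∀ y → (∀ p → g p ≢ y) → a < b
injective-missing⇒<-Bool× {a} {b} {g} g-injective y y∉g =
  ℕ.*-cancelˡ-< 2 a b (injective-missing⇒< h-injective (to (Bool×Fin↔Fin b) y) h-misses)
  where
  open Inverse using (to; from)
  to-injective : ∀ m → Injective _≡_ _≡_ (to (Bool×Fin↔Fin m))
  to-injective m = Injection.injective (↔⇒↣ (Bool×Fin↔Fin m))
  from-injective : ∀ m → Injective _≡_ _≡_ (from (Bool×Fin↔Fin m))
  from-injective m = Injection.injective (↔⇒↣ (↔-sym (Bool×Fin↔Fin m)))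
  h : Fin (2 ℕ.* a) → Fin (2 ℕ.* b)
  h = to (Bool×Fin↔Fin b) ∘ g ∘ from (Bool×Fin↔Fin a)
  h-injective : Injective _≡_ _≡_ h
  h-injective = from-injective a ∘ g-injective ∘ to-injective b
  h-misses : ∀ i → h i ≢ to (Bool×Fin↔Fin b) y
  h-misses i = y∉g (from (Bool×Fin↔Fin a) i) ∘ to-injective b

module TwoInvolutions {X : Set} (σ : Bool → X → X)
  (σ-involutive : ∀ s a → σ s (σ s a) ≡ a) (σ-fixpointFree : ∀ s a → σ s a ≢ a) where

  act : List Bool → X → X
  act []      a = a
  act (s ∷ w) a = σ s (act w a)

  act-++ : ∀ w w′ a → act (w ++ w′) a ≡ act w (act w′ a)
  act-++ []      w′ a = refl
  act-++ (s ∷ w) w′ a = cong (σ s) (act-++ w w′ a)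

  act-reverse : ∀ w a → act (reverse w) (act w a) ≡ a
  act-reverse []      a = refl
  act-reverse (s ∷ w) a = begin
    act (reverse (s ∷ w)) (σ s (act w a))      ≡⟨ cong (λ w′ → act w′ (σ s (act w a))) (unfold-reverse s w) ⟩
    act (reverse w ++ [ s ]) (σ s (act w a))   ≡⟨ act-++ (reverse w) [ s ] _ ⟩
    act (reverse w) (σ s (σ s (act w a)))      ≡⟨ cong (act (reverse w)) (σ-involutive s (act w a)) ⟩
    act (reverse w) (act w a)                  ≡⟨ act-reverse w a ⟩
    a                                          ∎
    where open ≡-Reasoning

  alternating : Bool → ℕ → X → X
  alternating s zero    a = a
  alternating s (suc m) a = σ s (alternating (not s) m a)

  innermost : Bool → ℕ → Bool
  innermost s zero    = s
  innermost s (suc m) = innermost (not s) m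

  alternating-innermost : ∀ s m a → alternating s (suc m) a ≡ alternating s m (σ (innermost s m) a)
  alternating-innermost s zero    a = refl
  alternating-innermost s (suc m) a = cong (σ s) (alternating-innermost (not s) m a)

  innermost-odd : ∀ s m → parity m ≡ 1ℙ → innermost s m ≡ not s
  innermost-odd s (suc zero)    _   = refl
  innermost-odd s (suc (suc m)) odd =
    trans (cong (λ t → innermost t m) (Bool.not-involutive s)) (innermost-odd s m odd)

  -- An odd alternating word is a palindrome, so it is conjugate to a single involution.
  odd-alternating-fixpointFree : ∀ m s a → parity m ≡ 1ℙ → alternating s m a ≢ a
  odd-alternating-fixpointFree (suc zero)    s a _   = σ-fixpointFree s a
  odd-alternating-fixpointFree (suc (suc m)) s a odd fixed =
    odd-alternating-fixpointFree m (not s) (σ s a) odd (begin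
      alternating (not s) m (σ s a)                        ≡⟨ cong (λ t → alternating (not s) m (σ t a)) s≡innermost ⟩
      alternating (not s) m (σ (innermost (not s) m) a)    ≡⟨ alternating-innermost (not s) m a ⟨
      alternating (not s) (suc m) a                        ≡⟨ σ-involutive s _ ⟨
      σ s (alternating s (suc (suc m)) a)                  ≡⟨ cong (σ s) fixed ⟩
      σ s a                                                ∎)
    where
    open ≡-Reasoning
    s≡innermost : s ≡ innermost (not s) m
    s≡innermost = sym (trans (innermost-odd (not s) m odd) (Bool.not-involutive s))

  push : Bool → Bool × ℕ → Bool × ℕ
  push s     (t     , zero)  = s , 1
  push true  (true  , suc m) = false , m
  push false (false , suc m) = true , m
  push true  (false , suc m) = true , suc (suc m)
  push false (true  , suc m) = false , suc (suc m)

  push-act : ∀ s ((t , m) : Bool × ℕ) a → uncurry alternating (push s (t , m)) a ≡ σ s (alternating t m a)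
  push-act s     (t     , zero)  a = refl
  push-act true  (true  , suc m) a = sym (σ-involutive true _)
  push-act false (false , suc m) a = sym (σ-involutive false _)
  push-act true  (false , suc m) a = refl
  push-act false (true  , suc m) a = refl

  push-parity : ∀ s ((t , m) : Bool × ℕ) → parity (proj₂ (push s (t , m))) ≡ parity (suc m)
  push-parity s     (t     , zero)  = refl
  push-parity true  (true  , suc m) = refl
  push-parity false (false , suc m) = refl
  push-parity true  (false , suc m) = refl
  push-parity false (true  , suc m) = refl

  normalForm : List Bool → Bool × ℕ
  normalForm = foldr push (true , 0)

  act-normalForm : ∀ w a → act w a ≡ uncurry alternating (normalForm w) a
  act-normalForm []      a = refl
  act-normalForm (s ∷ w) a = trans (cong (σ s) (act-normalForm w a)) (sym (push-act s (normalForm w) a))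

  normalForm-parity : ∀ w → parity (proj₂ (normalForm w)) ≡ parity (length w)
  normalForm-parity []      = refl
  normalForm-parity (s ∷ w) = begin
    parity (proj₂ (push s (normalForm w))) ≡⟨ push-parity s (normalForm w) ⟩
    parity (suc (proj₂ (normalForm w)))    ≡⟨ parity-suc (proj₂ (normalForm w)) ⟩
    parity (proj₂ (normalForm w)) ⁻¹       ≡⟨ cong _⁻¹ (normalForm-parity w) ⟩
    parity (length w) ⁻¹                   ≡⟨ parity-suc (length w) ⟨
    parity (suc (length w))                ∎
    where open ≡-Reasoning

  fixpoint⇒even : ∀ w a → act w a ≡ a → parity (length w) ≡ 0ℙ
  fixpoint⇒even w a fixed = decidable-stable (parity (length w) ℙ.≟ 0ℙ) λ odd →
    odd-alternating-fixpointFree (proj₂ (normalForm w)) (proj₁ (normalForm w)) a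
      (trans (normalForm-parity w) (≢⇒≡⁻¹ odd)) (trans (sym (act-normalForm w a)) fixed)

  same-endpoint⇒same-parity : ∀ w w′ a → act w a ≡ act w′ a → parity (length w) ≡ parity (length w′)
  same-endpoint⇒same-parity w w′ a w≈w′ = sym (parity-+≡0⇒≡ (length w′) (length w) (begin
    parity (length w′ + length w)               ≡⟨ cong parity (cong (_+ length w) (length-reverse w′)) ⟨
    parity (length (reverse w′) + length w)     ≡⟨ cong parity (length-++ (reverse w′)) ⟨
    parity (length (reverse w′ ++ w))           ≡⟨ fixpoint⇒even (reverse w′ ++ w) a closed ⟩
    0ℙ                                          ∎))
    where
    open ≡-Reasoning
    closed : act (reverse w′ ++ w) a ≡ a
    closed = trans (act-++ (reverse w′) w a) (trans (cong (act (reverse w′)) w≈w′) (act-reverse w′ a))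

other-vertex : ∀ {n} → 2 ≤ n → (v : Fin n) → Σ (Fin n) (v ≢_)
other-vertex (ℕ.s≤s (ℕ.s≤s ℕ.z≤n)) Fin.zero    = Fin.suc Fin.zero , λ ()
other-vertex (ℕ.s≤s (ℕ.s≤s ℕ.z≤n)) (Fin.suc v) = Fin.zero , λ ()

connected⇒neighbour : ∀ {n} (G : Graph n) → 2 ≤ n → Connected G → ∀ v → Σ (Fin n) λ u → adj G v u ≡ true
connected⇒neighbour G 2≤n connected v with other-vertex 2≤n v
... | w , v≢w = first-step (connected v w) v≢w
  where
  first-step : ∀ {v w} → Reach G v w → v ≢ w → Σ (Fin _) λ u → adj G v u ≡ true
  first-step here         v≢v = contradiction refl v≢v
  first-step (step v~u _) _   = _ , v~u

module _ {n} (G : Graph n) where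

  neighbourTerm : (Fin n → ℚ) → Fin n → Fin n → ℚ
  neighbourTerm x v u = if adj G v u then x u else 0ℚ

  mulA≡sum : ∀ x v → mulA G x v ≡ sum (neighbourTerm x v)
  mulA≡sum x v = sumFin≡sum n (neighbourTerm x v)

  automorphism-preserves-kernel : ∀ {x} ((π , _) : Aut G) → InKernel G x → InKernel G (x ∘ (π ⟨$⟩ʳ_))
  automorphism-preserves-kernel {x} (π , π-aut) x∈ker v = begin
    mulA G (x ∘ (π ⟨$⟩ʳ_)) v                   ≡⟨ mulA≡sum _ v ⟩
    sum (neighbourTerm (x ∘ (π ⟨$⟩ʳ_)) v)     ≡⟨ sum-cong-≗ (λ u → cong (λ b → if b then x (π ⟨$⟩ʳ u) else 0ℚ) (π-aut v u)) ⟨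
    sum (neighbourTerm x (π ⟨$⟩ʳ v) ∘ (π ⟨$⟩ʳ_)) ≡⟨ sum-permute (neighbourTerm x (π ⟨$⟩ʳ v)) π ⟨
    sum (neighbourTerm x (π ⟨$⟩ʳ v))           ≡⟨ mulA≡sum x (π ⟨$⟩ʳ v) ⟨
    mulA G x (π ⟨$⟩ʳ v)                         ≡⟨ x∈ker (π ⟨$⟩ʳ v) ⟩
    0ℚ                                          ∎
    where open ≡-Reasoning

  module _ {x : Fin n → ℚ} (x∈ker : InKernel G x) where

    scaled-neighbourhood-sum : ∀ c v → sum (λ u → c ℚ.* neighbourTerm x v u) ≡ 0ℚ
    scaled-neighbourhood-sum c v = begin
      sum (λ u → c ℚ.* neighbourTerm x v u) ≡⟨ *-distribˡ-sum c (neighbourTerm x v) ⟨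
      c ℚ.* sum (neighbourTerm x v)         ≡⟨ cong (c ℚ.*_) (trans (sym (mulA≡sum x v)) (x∈ker v)) ⟩
      c ℚ.* 0ℚ                              ≡⟨ ℚ.*-zeroʳ c ⟩
      0ℚ                                    ∎
      where open ≡-Reasoning

    ¬all-neighbour-terms-nonNeg : ∀ c v {u₀} → adj G v u₀ ≡ true → c ℚ.* x u₀ ≢ 0ℚ →
      ¬ (∀ u → adj G v u ≡ true → 0ℚ ℚ.≤ c ℚ.* x u)
    ¬all-neighbour-terms-nonNeg c v {u₀} v~u₀ cx≢0 all≥0 = cx≢0 (begin
      c ℚ.* x u₀                ≡⟨ cong (λ b → c ℚ.* (if b then x u₀ else 0ℚ)) v~u₀ ⟨
      c ℚ.* neighbourTerm x v u₀ ≡⟨ nonNeg-sum≡0 _ term≥0 (scaled-neighbourhood-sum c v) u₀ ⟩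
      0ℚ                        ∎)
      where
      open ≡-Reasoning
      term≥0 : ∀ u → 0ℚ ℚ.≤ c ℚ.* neighbourTerm x v u
      term≥0 u with adj G v u in v~u
      ... | true  = all≥0 u v~u
      ... | false = ℚ.≤-reflexive (sym (ℚ.*-zeroʳ c))

module NutGraph {n} (G : Graph n) {x : Fin n → ℚ} (x-spans : SpansKernel G x) (x≢0 : ∀ i → x i ≢ 0ℚ) where

  x∈ker : InKernel G x
  x∈ker = proj₁ x-spans

  multiple-of-x : ∀ y → InKernel G y → Σ ℚ λ c → ∀ i → y i ≡ c ℚ.* x i
  multiple-of-x = proj₂ (proj₂ x-spans)

  edgeSign : Fin n → Fin n → Bool
  edgeSign u v = isPositive (x u ℚ.* x v)

  edgeSign-sym : ∀ u v → edgeSign u v ≡ edgeSign v u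
  edgeSign-sym u v = cong isPositive (ℚ.*-comm (x u) (x v))

  edgeSign-aut : ((π , _) : Aut G) → ∀ u v → edgeSign (π ⟨$⟩ʳ u) (π ⟨$⟩ʳ v) ≡ edgeSign u v
  edgeSign-aut α@(π , _) u v = begin
    isPositive (x (π ⟨$⟩ʳ u) ℚ.* x (π ⟨$⟩ʳ v))     ≡⟨ cong isPositive (cong₂ ℚ._*_ (x∘π≡cx u) (x∘π≡cx v)) ⟩
    isPositive ((c ℚ.* x u) ℚ.* (c ℚ.* x v))      ≡⟨ cong isPositive (interchange c (x u) c (x v)) ⟩
    isPositive ((c ℚ.* c) ℚ.* (x u ℚ.* x v))      ≡⟨ isPositive-*-pos (x u ℚ.* x v) (square-pos c c≢0) ⟩
    isPositive (x u ℚ.* x v)                      ∎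
    where
    open ≡-Reasoning
    c : ℚ
    c = proj₁ (multiple-of-x (x ∘ (π ⟨$⟩ʳ_)) (automorphism-preserves-kernel G α x∈ker))
    x∘π≡cx : ∀ i → x (π ⟨$⟩ʳ i) ≡ c ℚ.* x i
    x∘π≡cx = proj₂ (multiple-of-x (x ∘ (π ⟨$⟩ʳ_)) (automorphism-preserves-kernel G α x∈ker))
    c≢0 : c ≢ 0ℚ
    c≢0 c≡0 = x≢0 (π ⟨$⟩ʳ u) (trans (x∘π≡cx u) (trans (cong (ℚ._* x u) c≡0) (ℚ.*-zeroˡ (x u))))

  -- If all neighbours had the same sign, the kernel equation at v multiplied by - x v or
  -- by x v would be a vanishing sum of nonnegative terms, one of them nonzero.
  signed-neighbour : ∀ v {u₀} → adj G v u₀ ≡ true → ∀ s → Σ (Fin n) λ u → adj G v u ≡ true × edgeSign v u ≡ s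
  signed-neighbour v {u₀} v~u₀ s = decidable-stable
    (any? λ u → (adj G v u Bool.≟ true) ×-dec (edgeSign v u Bool.≟ s))
    (λ none → one-signed s (λ u v~u → Bool.¬-not (λ sign≡s → none (u , v~u , sign≡s))))
    where
    one-signed : ∀ s → (∀ u → adj G v u ≡ true → edgeSign v u ≡ not s) → ⊥
    one-signed true all-nonPos = ¬all-neighbour-terms-nonNeg G x∈ker (ℚ.- x v) v v~u₀
      (*-≢0 (x≢0 v ∘ ℚ.neg-injective) (x≢0 u₀))
      (λ u v~u → subst (0ℚ ℚ.≤_) (ℚ.neg-distribˡ-* (x v) (x u))
                   (ℚ.neg-antimono-≤ (isPositive≡false⇒nonPos (all-nonPos u v~u))))
    one-signed false all-pos = ¬all-neighbour-terms-nonNeg G x∈ker (x v) v v~u₀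
      (*-≢0 (x≢0 v) (x≢0 u₀))
      (λ u v~u → ℚ.<⇒≤ (isPositive≡true⇒pos (all-pos u v~u)))

  keepEven : Parity → ℚ → ℚ
  keepEven 0ℙ q = q
  keepEven 1ℙ q = 0ℚ

  -- x restricted to one colour class of a proper 2-colouring is still in the kernel.
  properly-2-coloured⇒edgeless : (colour : Fin n → Parity) →
    (∀ u v → adj G u v ≡ true → colour u ≢ colour v) → ∀ {u v} → adj G u v ≢ true
  properly-2-coloured⇒edgeless colour proper {u} {v} u~v = endpoint-colours (colour u) refl
    where
    opposite : ∀ {i j} → adj G i j ≡ true → colour j ≡ colour i ⁻¹
    opposite {i} {j} i~j = ≢⇒≡⁻¹ (proper j i (trans (Graph.sym G j i) i~j))

    y : Fin n → ℚ
    y i = keepEven (colour i) (x i)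

    opposite-class-sum : ∀ i p → sum (neighbourTerm G (λ j → keepEven (p ⁻¹) (x j)) i) ≡ 0ℚ
    opposite-class-sum i 0ℙ = trans (sum-cong-≗ (λ j → Bool.if-eta (adj G i j))) (sum-replicate-zero n)
    opposite-class-sum i 1ℙ = trans (sym (mulA≡sum G x i)) (x∈ker i)

    y∈ker : InKernel G y
    y∈ker i = begin
      mulA G y i                                                 ≡⟨ mulA≡sum G y i ⟩
      sum (neighbourTerm G y i)                                  ≡⟨ sum-cong-≗ neighbour-in-opposite-class ⟩
      sum (neighbourTerm G (λ j → keepEven (colour i ⁻¹) (x j)) i) ≡⟨ opposite-class-sum i (colour i) ⟩
      0ℚ                                                         ∎
      where
      open ≡-Reasoning
      neighbour-in-opposite-class : ∀ j → neighbourTerm G y i j ≡ neighbourTerm G (λ j → keepEven (colour i ⁻¹) (x j)) i j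
      neighbour-in-opposite-class j with adj G i j in i~j
      ... | true  = cong (λ p → keepEven p (x j)) (opposite i~j)
      ... | false = refl

    ¬both-classes-inhabited : ∀ p q → colour p ≡ 0ℙ → colour q ≡ 1ℙ → ⊥
    ¬both-classes-inhabited p q colour-p colour-q = x≢0 p (begin
      x p          ≡⟨ cong (λ r → keepEven r (x p)) colour-p ⟨
      y p          ≡⟨ y≡cx p ⟩
      c ℚ.* x p    ≡⟨ cong (ℚ._* x p) c≡0 ⟩
      0ℚ ℚ.* x p   ≡⟨ ℚ.*-zeroˡ (x p) ⟩
      0ℚ           ∎)
      where
      open ≡-Reasoning
      c : ℚ
      c = proj₁ (multiple-of-x y y∈ker)
      y≡cx : ∀ i → y i ≡ c ℚ.* x i
      y≡cx = proj₂ (multiple-of-x y y∈ker)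
      c≡0 : c ≡ 0ℚ
      c≡0 = decidable-stable (c ℚ.≟ 0ℚ) λ c≢0 →
        *-≢0 c≢0 (x≢0 q) (trans (sym (y≡cx q)) (cong (λ r → keepEven r (x q)) colour-q))

    endpoint-colours : ∀ p → colour u ≡ p → ⊥
    endpoint-colours 0ℙ colour-u = ¬both-classes-inhabited u v colour-u (trans (opposite u~v) (cong _⁻¹ colour-u))
    endpoint-colours 1ℙ colour-u = ¬both-classes-inhabited v u (trans (opposite u~v) (cong _⁻¹ colour-u)) colour-u

module OrbitQuotient {n} (G : Graph n) {x : Fin n → ℚ} (x-spans : SpansKernel G x) (x≢0 : ∀ i → x i ≢ 0ℚ)
  (neighbour : ∀ v → Σ (Fin n) λ u → adj G v u ≡ true)
  {ov oe : ℕ} (VO : VertexOrbitCount G ov) (EO : EdgeOrbitCount G oe) where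

  open NutGraph G x-spans x≢0

  orbit : Fin n → Fin ov
  orbit = proj₁ VO

  orbit-aut : ((π , _) : Aut G) → ∀ u → orbit (π ⟨$⟩ʳ u) ≡ orbit u
  orbit-aut α u = sym (proj₂ (proj₂ (proj₂ VO) u _) (α , refl))

  representative : Fin ov → Fin n
  representative O = proj₁ (proj₁ (proj₂ VO) O)

  orbit-representative : ∀ O → orbit (representative O) ≡ O
  orbit-representative O = proj₂ (proj₁ (proj₂ VO) O)

  edgeOrbit : Edge G → Fin oe
  edgeOrbit = proj₁ EO

  representativeEdge : Fin oe → Edge G
  representativeEdge E = proj₁ (proj₁ (proj₂ EO) E)

  edgeOrbit-representativeEdge : ∀ E → edgeOrbit (representativeEdge E) ≡ E
  edgeOrbit-representativeEdge E = proj₂ (proj₁ (proj₂ EO) E)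

  tail head : Edge G → Fin n
  tail ε = proj₁ ε
  head ε = proj₁ (proj₂ ε)

  -- (b , E) stands for the edges of E oriented to start at the tail (b = true) or at the
  -- head (b = false) of the representative edge of E.
  HalfEdge : Set
  HalfEdge = Bool × Fin oe

  start : HalfEdge → Fin ov
  start (true  , E) = orbit (tail (representativeEdge E))
  start (false , E) = orbit (head (representativeEdge E))

  reverseHalf : HalfEdge → HalfEdge
  reverseHalf (b , E) = not b , E

  halfSign : HalfEdge → Bool
  halfSign (_ , E) = edgeSign (tail (representativeEdge E)) (head (representativeEdge E))

  start-reverseHalf² : ∀ h → start (reverseHalf (reverseHalf h)) ≡ start h
  start-reverseHalf² (b , E) = cong (λ b → start (b , E)) (Bool.not-involutive b)

  Represents : HalfEdge → Fin n → Fin n → Set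
  Represents h u v = start h ≡ orbit u × start (reverseHalf h) ≡ orbit v × halfSign h ≡ edgeSign u v

  represents-reverse : ∀ h {u v} → Represents h u v → Represents (reverseHalf h) v u
  represents-reverse h {u} {v} (start≡u , end≡v , sign≡) =
    end≡v , trans (start-reverseHalf² h) start≡u , trans sign≡ (edgeSign-sym u v)

  represents-aut : ∀ h {u v} ((π , _) : Aut G) → Represents h u v → Represents h (π ⟨$⟩ʳ u) (π ⟨$⟩ʳ v)
  represents-aut _ {u} {v} α (start≡u , end≡v , sign≡) =
    trans start≡u (sym (orbit-aut α u)) , trans end≡v (sym (orbit-aut α v)) , trans sign≡ (sym (edgeSign-aut α u v))

  edge-represented : (ε : Edge G) → Σ HalfEdge λ h → Represents h (tail ε) (head ε)
  edge-represented ε = from-automorphism (proj₁ (proj₂ (proj₂ EO) (representativeEdge E) ε) (edgeOrbit-representativeEdge E))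
    where
    E : Fin oe
    E = edgeOrbit ε
    representative-represented : ((π , _) : Aut G) →
      Represents (true , E) (π ⟨$⟩ʳ tail (representativeEdge E)) (π ⟨$⟩ʳ head (representativeEdge E))
    representative-represented α = represents-aut (true , E) α (refl , refl , refl)
    from-automorphism : SameEdgeOrbit G (representativeEdge E) ε → Σ HalfEdge λ h → Represents h (tail ε) (head ε)
    from-automorphism (α , inj₁ (tail↦tail , head↦head)) =
      (true , E) , subst₂ (Represents (true , E)) tail↦tail head↦head (representative-represented α)
    from-automorphism (α , inj₂ (tail↦head , head↦tail)) =
      (false , E) , represents-reverse (true , E) (subst₂ (Represents (true , E)) tail↦head head↦tail (representative-represented α))

  represented : ∀ u v → adj G u v ≡ true → Σ HalfEdge λ h → Represents h u v
  represented u v u~v with ℕ.<-cmp (Fin.toℕ u) (Fin.toℕ v)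
  ... | tri< u<v _ _ = edge-represented (u , v , u<v , u~v)
  ... | tri≈ _ u≡v _ = contradiction (trans (sym u~v) (trans (cong (adj G u) (sym (toℕ-injective u≡v))) (irrefl G u))) λ ()
  ... | tri> _ _ v<u = let h , rep = edge-represented (v , u , v<u , trans (Graph.sym G v u) u~v)
                       in reverseHalf h , represents-reverse h rep

  profile : HalfEdge → Bool × Fin ov
  profile h = halfSign h , start h

  chosenNeighbour : ∀ s O → Σ (Fin n) λ u → adj G (representative O) u ≡ true × edgeSign (representative O) u ≡ s
  chosenNeighbour s O = signed-neighbour (representative O) (proj₂ (neighbour (representative O))) s

  choose : Bool × Fin ov → HalfEdge
  choose (s , O) = proj₁ (represented _ _ (proj₁ (proj₂ (chosenNeighbour s O))))

  profile-choose : ∀ p → profile (choose p) ≡ p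
  profile-choose (s , O) with represented _ _ (proj₁ (proj₂ (chosenNeighbour s O)))
  ... | _ , start≡ , _ , sign≡ =
    cong₂ _,_ (trans sign≡ (proj₂ (proj₂ (chosenNeighbour s O)))) (trans start≡ (orbit-representative O))

  choose-injective : Injective _≡_ _≡_ choose
  choose-injective {p} {q} eq = trans (sym (profile-choose p)) (trans (cong profile eq) (profile-choose q))

  unchosen⇒< : ∀ h → choose (profile h) ≢ h → ov < oe
  unchosen⇒< h unchosen = injective-missing⇒<-Bool× choose-injective h λ p chosen →
    unchosen (trans (cong (choose ∘ profile) (sym chosen)) (trans (cong choose (profile-choose p)) chosen))

  -- all-chosen says that choose is onto, hence inverse to profile.
  module Quotient (all-chosen : ∀ h → choose (profile h) ≡ h) where

    σ : Bool → Fin ov → Fin ov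
    σ s O = start (reverseHalf (choose (s , O)))

    choose-reverse : ∀ s O → choose (s , σ s O) ≡ reverseHalf (choose (s , O))
    choose-reverse s O =
      trans (cong (λ t → choose (t , σ s O)) (sym (cong proj₁ (profile-choose (s , O))))) (all-chosen _)

    σ-involutive : ∀ s O → σ s (σ s O) ≡ O
    σ-involutive s O = begin
      start (reverseHalf (choose (s , σ s O)))              ≡⟨ cong (start ∘ reverseHalf) (choose-reverse s O) ⟩
      start (reverseHalf (reverseHalf (choose (s , O))))    ≡⟨ start-reverseHalf² (choose (s , O)) ⟩
      start (choose (s , O))                                ≡⟨ cong proj₂ (profile-choose (s , O)) ⟩
      O                                                     ∎
      where open ≡-Reasoning

    σ-fixpointFree : ∀ s O → σ s O ≢ O
    σ-fixpointFree s O fixed = Bool.not-¬ refl (sym (cong proj₁ (begin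
      reverseHalf (choose (s , O)) ≡⟨ choose-reverse s O ⟨
      choose (s , σ s O)           ≡⟨ cong (λ O′ → choose (s , O′)) fixed ⟩
      choose (s , O)               ∎)))
      where open ≡-Reasoning

    σ-edge : ∀ {u v} → adj G u v ≡ true → σ (edgeSign u v) (orbit u) ≡ orbit v
    σ-edge {u} {v} u~v with represented u v u~v
    ... | h , (start≡u , end≡v , sign≡) =
      trans (cong (start ∘ reverseHalf) (trans (cong choose (sym (cong₂ _,_ sign≡ start≡u))) (all-chosen h))) end≡v

    σ-edge⁻¹ : ∀ {u v} → adj G u v ≡ true → σ (edgeSign u v) (orbit v) ≡ orbit u
    σ-edge⁻¹ {u} {v} u~v =
      trans (cong (λ s → σ s (orbit v)) (edgeSign-sym u v)) (σ-edge (trans (Graph.sym G v u) u~v))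

    open TwoInvolutions σ σ-involutive σ-fixpointFree

    walkSigns : ∀ {u w} → Reach G u w → List Bool
    walkSigns here                 = []
    walkSigns (step {u} {v} _ r) = edgeSign u v ∷ walkSigns r

    act-walkSigns : ∀ {u w} (r : Reach G u w) → act (walkSigns r) (orbit w) ≡ orbit u
    act-walkSigns here           = refl
    act-walkSigns (step u~v r) = trans (cong (σ _) (act-walkSigns r)) (σ-edge⁻¹ u~v)

    module _ (connected : Connected G) (root : Fin n) where

      colour : Fin n → Parity
      colour v = parity (length (walkSigns (connected v root)))

      colour-proper : ∀ u v → adj G u v ≡ true → colour u ≢ colour v
      colour-proper u v u~v colour-u≡colour-v = ℙ.p≢p⁻¹ (colour v) (begin
        colour v                                                      ≡⟨ colour-u≡colour-v ⟨
        parity (length (walkSigns (connected u root)))                ≡⟨ via-v ⟨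
        parity (suc (length (walkSigns (connected v root))))          ≡⟨ parity-suc (length (walkSigns (connected v root))) ⟩
        colour v ⁻¹                                                   ∎)
        where
        open ≡-Reasoning
        via-v : parity (length (edgeSign u v ∷ walkSigns (connected v root))) ≡ colour u
        via-v = same-endpoint⇒same-parity (edgeSign u v ∷ walkSigns (connected v root)) (walkSigns (connected u root)) (orbit root)
          (trans (cong (σ _) (act-walkSigns (connected v root)))
                 (trans (σ-edge⁻¹ u~v) (sym (act-walkSigns (connected u root)))))

theorem1 : ∀ (n : ℕ) (G : Graph n) → Connected G → IsNut G →
    ∀ (ov oe : ℕ) → VertexOrbitCount G ov → EdgeOrbitCount G oe →
    ov + 1 ≤ oe
theorem1 n G connected (2≤n , x , x-spans , x≢0) ov oe VO EO =
  decidable-stable (ov ℕ.+ 1 ℕ.≤? oe) λ ov+1≰oe →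
    let open Quotient (all-chosen ov+1≰oe)
    in properly-2-coloured⇒edgeless (colour connected root) (colour-proper connected root) (proj₂ (neighbour root))
  where
  open NutGraph G x-spans x≢0
  neighbour : ∀ v → Σ (Fin n) λ u → adj G v u ≡ true
  neighbour = connected⇒neighbour G 2≤n connected
  open OrbitQuotient G x-spans x≢0 neighbour VO EO
  root : Fin n
  root = Fin.fromℕ< 2≤n
  all-chosen : ¬ (ov + 1 ≤ oe) → ∀ h → choose (profile h) ≡ h
  all-chosen ov+1≰oe h = decidable-stable (≡-dec Bool._≟_ Fin._≟_ (choose (profile h)) h)
    (ov+1≰oe ∘ subst (_≤ oe) (ℕ.+-comm 1 ov) ∘ unchosen⇒< h)
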